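{- Fix a positive integer $n$. Every functional tree $g:\mathbb{Z}_n\to\mathbb{Z}_n$ admits a $\vec{\beta}$-labeling if and only if, for every $g:\mathbb{Z}_n\to\mathbb{Z}_n$ with $|g^{(n-1)}(\mathbb{Z}_n)|=1$, the implication "$\overline{\mathcal{P}}_{g^{(2)}}(\mathbf{x})$ is not identically zero $\Rightarrow$ $\overline{\mathcal{P}}_{g}(\mathbf{x})$ is not identically zero" holds.
   Context: $\mathbb{Z}_n=\{0,\ldots,n-1\}$ as integers. For $g:\mathbb{Z}_n\to\mathbb{Z}_n$, $g^{(0)}=\mathrm{id}$, $g^{(j+1)}=g\circ g^{(j)}$. $g$ is a functional tree if $|g^{(n-1)}(\mathbb{Z}_n)|=1$; then it has a unique root $r$ with $g(r)=r$, and $d_g(v)$ is the least $j\ge0$ with $g^{(j)}(v)=r$. $\mathrm{S}_n$ is the set of bijections of $\mathbb{Z}_n$. A functional tree $g$ admits a $\vec{\beta}$-labeling if there is $\sigma\in\mathrm{S}_n$ such that, with $h=\sigma g\sigma^{ -1}$, $\{(-1)^{d_h(v)}(h(v)-v):v\in\mathbb{Z}_n\}=\mathbb{Z}_n$ (integer arithmetic). Let $\mathbf{x}=(x_0,\ldots,x_{n-1})$. For a functional tree $g$ put $\mathfrak{e}_v=(-1)^{d_g(v)}(x_{g(v)}-x_v)$ and define the polynomial certificate $$\mathcal{P}_g(\mathbf{x})=\prod_{0\le u<v<n}(x_v-x_u)\cdot\prod_{0\le u<v<n}(\mathfrak{e}_v-\mathfrak{e}_u)\cdot\prod_{0\le v<n}\prod_{0<i<n}(\mathfrak{e}_v+i)\in\mathbb{Z}[\mathbf{x}].$$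 For $H\in\mathbb{Q}[\mathbf{x}]$, its canonical representative $\overline{H}$ is the unique polynomial of degree at most $n-1$ in each variable that is congruent to $H$ modulo the ideal generated by $\{(x_k)^{\underline{n}}:k\in\mathbb{Z}_n\}$, where $x^{\underline{n}}=x(x-1)\cdots(x-n+1)$; explicitly $\overline{H}=\sum_{f\in\mathbb{Z}_n^{\mathbb{Z}_n}}H(f(0),\ldots,f(n-1))\,L_f(\mathbf{x})$ with $L_f(\mathbf{x})=\prod_{i\in\mathbb{Z}_n}\prod_{j\in\mathbb{Z}_n\setminus\{f(i)\}}\frac{x_i-j}{f(i)-j}$. -}

module Defs where

open import Data.Nat using (ℕ; zero; suc; _∸_)
open import Data.Bool using (Bool; true; false; if_then_else_)
open import Data.Fin using (Fin; toℕ; _≟_; _<?_)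
open import Data.Fin.Properties using (any?)
open import Data.Fin.Subset using (Subset; ∣_∣)
open import Data.Vec using (tabulate)
open import Data.List using (List; []; _∷_; map; concatMap; foldr)
open import Data.List using (allFin)
open import Data.Integer using (ℤ; +_; -_) renaming (_-_ to _-ℤ_)
open import Data.Rational as ℚ using (ℚ; 0ℚ; 1ℚ; _+_; _*_; _-_; _÷_; ≢-nonZero)
open import Data.Rational using () renaming (_/_ to _//_)
open import Data.Product using (Σ; ∃; _×_; _,_)
open import Function.Bundles using (_↔_; Inverse)
open import Relation.Binary.PropositionalEquality using (_≡_; _≢_)
open import Relation.Nullary using (does; yes; no)

iterate : {n : ℕ} → ℕ → (Fin n → Fin n) → Fin n → Fin n
iterate zero    g v = v
iterate (suc j) g v = g (iterate j g v)

imageIter : (n : ℕ) → (Fin n → Fin n) → Subset n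
imageIter n g = tabulate (λ w → does (any? (λ v → iterate (n ∸ 1) g v ≟ w)))

IsFunctionalTree : (n : ℕ) → (Fin n → Fin n) → Set
IsFunctionalTree n g = ∣ imageIter n g ∣ ≡ 1

-- least j < fuel with p j (or fuel if none)
least : ℕ → (ℕ → Bool) → ℕ
least zero    p = zero
least (suc k) p = if p zero then zero else suc (least k (λ j → p (suc j)))

-- d_g(v): least j ≥ 0 with g^(j)(v) = r, where for a functional tree the
-- root r equals g^(n-1)(v) (for every v).  The search is bounded by n,
-- which suffices since d_g(v) ≤ n-1 for functional trees.
depth : (n : ℕ) → (Fin n → Fin n) → Fin n → ℕ
depth n g v = least n (λ j → does (iterate j g v ≟ iterate (n ∸ 1) g v))

isEven : ℕ → Bool
isEven zero = true
isEven (suc d) = if isEven d then false else true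

signℤ : ℕ → ℤ → ℤ
signℤ d z = if isEven d then z else - z

signℚ : ℕ → ℚ → ℚ
signℚ d q = if isEven d then q else ℚ.- q

finℤ : {n : ℕ} → Fin n → ℤ
finℤ i = + toℕ i

finℚ : {n : ℕ} → Fin n → ℚ
finℚ i = (+ toℕ i) // 1

conj : {n : ℕ} → (Fin n ↔ Fin n) → (Fin n → Fin n) → Fin n → Fin n
conj σ g v = Inverse.to σ (g (Inverse.from σ v))

βlabel : (n : ℕ) → (Fin n → Fin n) → Fin n → ℤ
βlabel n h v = signℤ (depth n h v) (finℤ (h v) -ℤ finℤ v)

LabelSetIsZn : (n : ℕ) → (Fin n → Fin n) → Set
LabelSetIsZn n h =
  ((v : Fin n) → ∃ λ (k : Fin n) → βlabel n h v ≡ finℤ k)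
  × ((k : Fin n) → ∃ λ (v : Fin n) → βlabel n h v ≡ finℤ k)

AdmitsβLabeling : (n : ℕ) → (Fin n → Fin n) → Set
AdmitsβLabeling n g = Σ (Fin n ↔ Fin n) λ σ → LabelSetIsZn n (conj σ g)

prodL : List ℚ → ℚ
prodL = foldr _*_ 1ℚ

sumL : List ℚ → ℚ
sumL = foldr _+_ 0ℚ

prodFin : (n : ℕ) → (Fin n → ℚ) → ℚ
prodFin n F = prodL (map F (allFin n))

prodPairs : (n : ℕ) → (Fin n → Fin n → ℚ) → ℚ
prodPairs n F = prodFin n (λ u → prodFin n (λ v →
  if does (u <? v) then F u v else 1ℚ))

allFuns : (m n : ℕ) → List (Fin m → Fin n)
allFuns zero    n = (λ ()) ∷ []
allFuns (suc m) n = concatMap (λ a → map (λ f → cons a f) (allFuns m n)) (allFin n)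
  where
  cons : Fin n → (Fin m → Fin n) → Fin (suc m) → Fin n
  cons a f Fin.zero    = a
  cons a f (Fin.suc i) = f i

-- The polynomial certificate P_g, as a polynomial function of x ∈ ℚ^n.

𝔢 : (n : ℕ) → (Fin n → Fin n) → (Fin n → ℚ) → Fin n → ℚ
𝔢 n g x v = signℚ (depth n g v) (x (g v) - x v)

certificate : (n : ℕ) → (Fin n → Fin n) → (Fin n → ℚ) → ℚ
certificate n g x =
  prodPairs n (λ u v → x v - x u)
  * prodPairs n (λ u v → 𝔢 n g x v - 𝔢 n g x u)
  * prodFin n (λ v → prodFin n (λ i →
      if does (toℕ i Data.Nat.≟ 0) then 1ℚ else 𝔢 n g x v + finℚ i))
  where import Data.Nat

-- division; the denominator is nonzero wherever used below
_/'_ : ℚ → ℚ → ℚ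
p /' q with q ℚ.≟ 0ℚ
... | yes _  = 0ℚ
... | no q≢0 = _÷_ p q {{≢-nonZero q≢0}}

lagrange : (n : ℕ) → (Fin n → Fin n) → (Fin n → ℚ) → ℚ
lagrange n f x = prodFin n (λ i → prodFin n (λ j →
  if does (j ≟ f i) then 1ℚ else ((x i - finℚ j) /' (finℚ (f i) - finℚ j))))

-- canonical representative  H̄ = Σ_f H(f(0),…,f(n-1)) L_f(x)
canonical : (n : ℕ) → ((Fin n → ℚ) → ℚ) → (Fin n → ℚ) → ℚ
canonical n H x = sumL (map (λ f → H (λ i → finℚ (f i)) * lagrange n f x) (allFuns n n))

-- a polynomial over ℚ (an infinite field) is not identically zero iff
-- it takes a nonzero value at some point of ℚ^n
NotIdenticallyZero : (n : ℕ) → ((Fin n → ℚ) → ℚ) → Set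
NotIdenticallyZero n P = ∃ λ (x : Fin n → ℚ) → P x ≢ 0ℚ

sq : {n : ℕ} → (Fin n → Fin n) → Fin n → Fin n
sq g = iterate 2 g

-- The canonical representative agrees with 𝒫_g at every point f : ℤₙ → ℤₙ of the grid ℤₙⁿ
-- (Lagrange interpolation), so it is not identically zero iff 𝒫_g(f) ≠ 0 for some f.  The
-- three factors of 𝒫_g(f) are nonzero exactly when f is injective, the edge labels
-- (−1)^{d(v)} (f(g v) − f v) are pairwise distinct, and none of them equals −1, …, −(n−1);
-- as they lie strictly between −n and n, this says that f conjugates g to a map with a
-- β-labelling.  So the right-hand side says: if g∘g admits a β-labelling, so does g.
-- Repeated squaring keeps a functional tree a functional tree with the same root and after
-- n−1 squarings yields the constant map onto the root, which admits a β-labelling (give the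
-- root the number 0); descending the chain of squares gives a β-labelling of g.
module Submission where

open import Defs
open import Data.Nat using (ℕ; _<_)
open import Data.Fin using (Fin)
open import Function.Bundles using (_⇔_)

open import Data.Bool using (Bool; true; false; if_then_else_)
import Data.Fin as Fin
import Data.Fin.Permutation as Permutation
import Data.Fin.Properties as Fin
open import Data.Fin.Subset using (Subset; ∣_∣; ⁅_⁆) renaming (_∈_ to _∈ₛ_)
import Data.Fin.Subset as Subset
import Data.Fin.Subset.Properties as Subset
open import Data.Integer as ℤ using (ℤ; 0ℤ)
import Data.Integer.Properties as ℤ
open import Data.List using (List; []; _∷_; map; allFin; tabulate; concatMap; _++_)
open import Data.List.Membership.Propositional using (_∈_)
open import Data.List.Membership.Propositional.Properties using (∈-allFin)
open import Data.List.Properties using (map-cong; map-∘; map-++; map-tabulate)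
open import Data.List.Relation.Unary.Any using (here; there)
open import Data.Nat as ℕ using (zero; suc)
import Data.Nat.Properties as ℕ
open import Data.Product using (∃; _×_; _,_; proj₁; proj₂; map₂)
open import Data.Rational as ℚ using (ℚ; 0ℚ; 1ℚ; _+_; _*_; _-_; -_; ↥_)
import Data.Rational.Properties as ℚ
import Data.Rational.Unnormalised as ℚᵘ
import Data.Rational.Unnormalised.Properties as ℚᵘ
open import Algebra.Properties.Group ℚ.+-0-group using (x∙y⁻¹≈ε⇒x≈y; x≈y⇒x∙y⁻¹≈ε)
open import Data.Sum as Sum using (_⊎_; [_,_]′)
import Data.Vec as Vec
import Data.Vec.Properties as Vec
open import Function using (_∘_)
open import Function.Bundles using (mk⇔; Equivalence; Inverse; Injection; _↔_; mk↔ₛ′)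
open import Function.Construct.Symmetry using (↔-sym)
open import Function.Definitions using (Injective)
import Function.Properties.Equivalence as ⇔
open import Function.Properties.Inverse using (↔⇒↣)
open import Relation.Binary.Definitions using (tri<; tri≈; tri>)
open import Relation.Binary.PropositionalEquality
open import Relation.Nullary using (¬_; Dec; yes; no; does; contradiction)
open import Relation.Nullary.Decidable using (decidable-stable; dec-true; dec-false)

private variable
  n : ℕ

injective⇒surjective : {f : Fin n → Fin n} → Injective _≡_ _≡_ f → ∀ y → ∃ λ x → f x ≡ y
injective⇒surjective {zero}  _     ()
injective⇒surjective {suc n} {f} f-inj y with Fin.any? (λ x → f x Fin.≟ y)
... | yes hit = hit
... | no miss = contradiction (Fin.injective⇒≤ punched-injective) ℕ.1+n≰n
  where
  y≢f : ∀ x → y ≢ f x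
  y≢f x y≡fx = miss (x , sym y≡fx)
  punched-injective : Injective _≡_ _≡_ (λ x → Fin.punchOut (y≢f x))
  punched-injective = f-inj ∘ Fin.punchOut-injective (y≢f _) (y≢f _)

surjective⇒injective : {f : Fin n → Fin n} → (∀ y → ∃ λ x → f x ≡ y) → Injective _≡_ _≡_ f
surjective⇒injective {f = f} f-surj {a} {b} fa≡fb =
  trans (sym (section-retracts a)) (trans (cong section fa≡fb) (section-retracts b))
  where
  section : Fin _ → Fin _
  section y = proj₁ (f-surj y)
  section-injective : Injective _≡_ _≡_ section
  section-injective {y} {y′} eq = trans (sym (proj₂ (f-surj y))) (trans (cong f eq) (proj₂ (f-surj y′)))
  section-retracts : ∀ x → section (f x) ≡ x
  section-retracts x with injective⇒surjective section-injective x
  ... | y , refl = cong section (proj₂ (f-surj y))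

injective⇒↔ : {f : Fin n → Fin n} → Injective _≡_ _≡_ f → Fin n ↔ Fin n
injective⇒↔ {f = f} f-inj = mk↔ₛ′ f (proj₁ ∘ surj) (proj₂ ∘ surj) (λ x → f-inj (proj₂ (surj (f x))))
  where surj = injective⇒surjective f-inj

toℚ : ℤ → ℚ
toℚ z = z ℚ./ 1

toℚ-injective : Injective _≡_ _≡_ toℚ
toℚ-injective {a} {b} eq with ℚ.fromℚᵘ-injective {ℚᵘ.mkℚᵘ a 0} {ℚᵘ.mkℚᵘ b 0} eq
... | ℚᵘ.*≡* a*1≡b*1 = trans (sym (ℤ.*-identityʳ a)) (trans a*1≡b*1 (ℤ.*-identityʳ b))

-- toℚ z is definitionally fromℚᵘ (mkℚᵘ z 0).
toℚᵘ-toℚ : ∀ z → ℚ.toℚᵘ (toℚ z) ℚᵘ.≃ ℚᵘ.mkℚᵘ z 0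
toℚᵘ-toℚ z = ℚ.toℚᵘ-fromℚᵘ (ℚᵘ.mkℚᵘ z 0)

toℚ-homo-+ : ∀ a b → toℚ (a ℤ.+ b) ≡ toℚ a + toℚ b
toℚ-homo-+ a b = ℚ.toℚᵘ-injective (ℚᵘ.≃-trans (toℚᵘ-toℚ (a ℤ.+ b)) (ℚᵘ.≃-sym (ℚᵘ.≃-trans
  (ℚ.toℚᵘ-homo-+ (toℚ a) (toℚ b))
  (ℚᵘ.≃-trans (ℚᵘ.+-cong (toℚᵘ-toℚ a) (toℚᵘ-toℚ b))
    (ℚᵘ.≃-reflexive (cong₂ (λ x y → ℚᵘ.mkℚᵘ (x ℤ.+ y) 0) (ℤ.*-identityʳ a) (ℤ.*-identityʳ b)))))))

toℚ-homo‿- : ∀ a → toℚ (ℤ.- a) ≡ - toℚ a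
toℚ-homo‿- a = ℚ.toℚᵘ-injective (ℚᵘ.≃-trans (toℚᵘ-toℚ (ℤ.- a)) (ℚᵘ.≃-sym (ℚᵘ.≃-trans
  (ℚ.toℚᵘ-homo‿- (toℚ a)) (ℚᵘ.-‿cong (toℚᵘ-toℚ a)))))

toℚ-homo-minus : ∀ a b → toℚ (a ℤ.- b) ≡ toℚ a - toℚ b
toℚ-homo-minus a b = trans (toℚ-homo-+ a (ℤ.- b)) (cong (λ q → toℚ a + q) (toℚ-homo‿- b))

p-q≢0⇔p≢q : ∀ {p q} → p - q ≢ 0ℚ ⇔ p ≢ q
p-q≢0⇔p≢q {p} {q} = mk⇔
  (λ ne p≡q → ne (x≈y⇒x∙y⁻¹≈ε p≡q))
  (λ ne → ne ∘ x∙y⁻¹≈ε⇒x≈y p q)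

finℤ-injective : Injective _≡_ _≡_ (finℤ {n})
finℤ-injective = Fin.toℕ-injective ∘ ℤ.+-injective

finℚ-injective : Injective _≡_ _≡_ (finℚ {n})
finℚ-injective = finℤ-injective ∘ toℚ-injective

p*q≡0⇒p≡0∨q≡0 : ∀ p q → p * q ≡ 0ℚ → p ≡ 0ℚ ⊎ q ≡ 0ℚ
p*q≡0⇒p≡0∨q≡0 p q pq≡0 =
  Sum.map (ℚ.↥p≡0⇒p≡0 p) (ℚ.↥p≡0⇒p≡0 q) (ℤ.i*j≡0⇒i≡0∨j≡0 (↥ p) ↥p*↥q≡0)
  where
  ↥p*↥q≡0 : ↥ p ℤ.* ↥ q ≡ 0ℤ
  ↥p*↥q≡0 with ↥ (p * q) | ℚ.p≡0⇒↥p≡0 _ pq≡0 | ℚ.↥-* p q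
  ... | _ | refl | ↥[pq]*nf≡↥p*↥q = sym ↥[pq]*nf≡↥p*↥q

*≢0⇔ : ∀ {p q} → p * q ≢ 0ℚ ⇔ (p ≢ 0ℚ × q ≢ 0ℚ)
*≢0⇔ {p} {q} = mk⇔
  (λ pq≢0 → (λ p≡0 → pq≢0 (trans (cong (_* q) p≡0) (ℚ.*-zeroˡ q)))
          , (λ q≡0 → pq≢0 (trans (cong (p *_) q≡0) (ℚ.*-zeroʳ p))))
  (λ (p≢0 , q≢0) → [ p≢0 , q≢0 ]′ ∘ p*q≡0⇒p≡0∨q≡0 p q)

prodL-map≢0⇔ : {A : Set} (F : A → ℚ) (xs : List A) →
               prodL (map F xs) ≢ 0ℚ ⇔ (∀ {x} → x ∈ xs → F x ≢ 0ℚ)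
prodL-map≢0⇔ F []       = mk⇔ (λ _ ()) (λ _ ())
prodL-map≢0⇔ F (x ∷ xs) = mk⇔
  (λ ne → let Fx≢0 , rest≢0 = Equivalence.to *≢0⇔ ne in
          λ { (here refl) → Fx≢0 ; (there x∈xs) → Equivalence.to (prodL-map≢0⇔ F xs) rest≢0 x∈xs })
  (λ all≢0 → Equivalence.from *≢0⇔
    (all≢0 (here refl) , Equivalence.from (prodL-map≢0⇔ F xs) (λ y∈xs → all≢0 (there y∈xs))))

prodFin≢0⇔ : {F : Fin n → ℚ} → prodFin n F ≢ 0ℚ ⇔ (∀ v → F v ≢ 0ℚ)
prodFin≢0⇔ {n} {F} = mk⇔
  (λ ne v → Equivalence.to (prodL-map≢0⇔ F (allFin n)) ne (∈-allFin v))
  (λ all≢0 → Equivalence.from (prodL-map≢0⇔ F (allFin n)) (λ {v} _ → all≢0 v))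

prodFin≡0 : {F : Fin n → ℚ} (v : Fin n) → F v ≡ 0ℚ → prodFin n F ≡ 0ℚ
prodFin≡0 v Fv≡0 = decidable-stable (_ ℚ.≟ 0ℚ) λ ne → Equivalence.to prodFin≢0⇔ ne v Fv≡0

prodFin≡1 : {F : Fin n → ℚ} → (∀ v → F v ≡ 1ℚ) → prodFin n F ≡ 1ℚ
prodFin≡1 {n} {F} all≡1 = go (allFin n)
  where
  go : (xs : List (Fin n)) → prodL (map F xs) ≡ 1ℚ
  go []       = refl
  go (x ∷ xs) = cong₂ _*_ (all≡1 x) (go xs)

prodFin-cong : {F G : Fin n → ℚ} → (∀ v → F v ≡ G v) → prodFin n F ≡ prodFin n G
prodFin-cong {n} F≗G = cong prodL (map-cong F≗G (allFin n))

sumL-map≢0⇒ : {A : Set} (F : A → ℚ) (xs : List A) → sumL (map F xs) ≢ 0ℚ → ∃ λ x → F x ≢ 0ℚ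
sumL-map≢0⇒ F []       ne = contradiction refl ne
sumL-map≢0⇒ F (x ∷ xs) ne with F x ℚ.≟ 0ℚ
... | no  Fx≢0 = x , Fx≢0
... | yes Fx≡0 = sumL-map≢0⇒ F xs λ rest≡0 → ne (cong₂ _+_ Fx≡0 rest≡0)

sumL-map≡0 : {A : Set} (F : A → ℚ) (xs : List A) → (∀ x → F x ≡ 0ℚ) → sumL (map F xs) ≡ 0ℚ
sumL-map≡0 F []       _     = refl
sumL-map≡0 F (x ∷ xs) all≡0 = cong₂ _+_ (all≡0 x) (sumL-map≡0 F xs all≡0)

sumL-++ : (xs ys : List ℚ) → sumL (xs ++ ys) ≡ sumL xs + sumL ys
sumL-++ []       ys = sym (ℚ.+-identityˡ _)
sumL-++ (x ∷ xs) ys = trans (cong (x +_) (sumL-++ xs ys)) (sym (ℚ.+-assoc x _ _))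

sumL-concatMap : {A B : Set} (F : B → ℚ) (G : A → List B) (xs : List A) →
                 sumL (map F (concatMap G xs)) ≡ sumL (map (λ a → sumL (map F (G a))) xs)
sumL-concatMap F G []       = refl
sumL-concatMap F G (x ∷ xs) = begin
  sumL (map F (G x ++ concatMap G xs))                ≡⟨ cong sumL (map-++ F (G x) _) ⟩
  sumL (map F (G x) ++ map F (concatMap G xs))        ≡⟨ sumL-++ (map F (G x)) _ ⟩
  sumL (map F (G x)) + sumL (map F (concatMap G xs))  ≡⟨ cong (sumL (map F (G x)) +_) (sumL-concatMap F G xs) ⟩
  sumL (map F (G x)) + sumL (map (λ a → sumL (map F (G a))) xs) ∎
  where open ≡-Reasoning

sumFin-single : {G : Fin n → ℚ} (b : Fin n) → (∀ a → a ≢ b → G a ≡ 0ℚ) →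
                sumL (map G (allFin n)) ≡ G b
sumFin-single {n} {G} b off-b = trans (cong sumL (map-tabulate (λ a → a) G)) (go b off-b)
  where
  go : ∀ {m} {H : Fin m → ℚ} (b : Fin m) → (∀ a → a ≢ b → H a ≡ 0ℚ) → sumL (tabulate H) ≡ H b
  go {suc m} {H} Fin.zero off-b = trans (cong (H Fin.zero +_)
    (trans (cong sumL (sym (map-tabulate (λ a → a) (H ∘ Fin.suc))))
           (sumL-map≡0 _ (allFin m) λ a → off-b (Fin.suc a) λ ())))
    (ℚ.+-identityʳ _)
  go {suc m} {H} (Fin.suc b) off-b = trans (cong₂ _+_ (off-b Fin.zero λ ())
    (go b λ a a≢b → off-b (Fin.suc a) (a≢b ∘ Fin.suc-injective))) (ℚ.+-identityˡ _)

sumL-allFuns-δ : ∀ {n} m (f : Fin m → Fin n) (c : ℚ) (F : (Fin m → Fin n) → ℚ) →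
                 (∀ f′ → f′ ≗ f → F f′ ≡ c) → (∀ f′ i → f′ i ≢ f i → F f′ ≡ 0ℚ) →
                 sumL (map F (allFuns m n)) ≡ c
sumL-allFuns-δ zero    f c F at-f off-f = trans (ℚ.+-identityʳ _) (at-f _ λ ())
sumL-allFuns-δ {n} (suc m) f c F at-f off-f = prepend _ (λ _ _ → refl) (λ _ _ _ → refl)
  where
  -- allFuns (suc m) n is built with a helper local to Defs that cannot be named here, so the
  -- step abstracts over it and its two defining equations.
  prepend : (cons : Fin n → (Fin m → Fin n) → Fin (suc m) → Fin n) →
            (∀ a f′ → cons a f′ Fin.zero ≡ a) → (∀ a f′ i → cons a f′ (Fin.suc i) ≡ f′ i) →
            sumL (map F (concatMap (λ a → map (cons a) (allFuns m n)) (allFin n))) ≡ c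
  prepend cons cons-zero cons-suc = begin
    sumL (map F (concatMap (λ a → map (cons a) (allFuns m n)) (allFin n)))
      ≡⟨ sumL-concatMap F _ (allFin n) ⟩
    sumL (map (λ a → sumL (map F (map (cons a) (allFuns m n)))) (allFin n))
      ≡⟨ sumFin-single (f Fin.zero) (λ a a≢f0 → trans (cong sumL (sym (map-∘ {g = F} (allFuns m n))))
           (sumL-map≡0 (F ∘ cons a) (allFuns m n) λ f′ →
             off-f _ Fin.zero (a≢f0 ∘ trans (sym (cons-zero a f′))))) ⟩
    sumL (map F (map (cons (f Fin.zero)) (allFuns m n)))
      ≡⟨ cong sumL (sym (map-∘ {g = F} (allFuns m n))) ⟩
    sumL (map (F ∘ cons (f Fin.zero)) (allFuns m n))
      ≡⟨ sumL-allFuns-δ m (f ∘ Fin.suc) c (F ∘ cons (f Fin.zero))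
           (λ f′ f′≗ → at-f _ λ { Fin.zero    → cons-zero _ _
                               ; (Fin.suc i) → trans (cons-suc _ _ i) (f′≗ i) })
           (λ f′ i f′i≢ → off-f _ (Fin.suc i) (f′i≢ ∘ trans (sym (cons-suc _ _ i)))) ⟩
    c ∎
    where open ≡-Reasoning

-- Lagrange interpolation on ℤₙⁿ

gridPoint : (Fin n → Fin n) → Fin n → ℚ
gridPoint f i = finℚ (f i)

p/'p≡1 : ∀ {p} → p ≢ 0ℚ → p /' p ≡ 1ℚ
p/'p≡1 {p} p≢0 with p ℚ.≟ 0ℚ
... | yes p≡0 = contradiction p≡0 p≢0
... | no  p≢0 = ℚ.*-inverseʳ p {{ℚ.≢-nonZero p≢0}}

0/'p≡0 : ∀ p → 0ℚ /' p ≡ 0ℚ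
0/'p≡0 p with p ℚ.≟ 0ℚ
... | yes _   = refl
... | no  p≢0 = ℚ.*-zeroˡ ((ℚ.1/ p) {{ℚ.≢-nonZero p≢0}})

module _ {n : ℕ} {f′ f : Fin n → Fin n} where

  lagrange-gridPoint-≗ : f′ ≗ f → lagrange n f′ (gridPoint f) ≡ 1ℚ
  lagrange-gridPoint-≗ f′≗f = prodFin≡1 λ i → prodFin≡1 λ j → factor≡1 i j (j Fin.≟ f′ i)
    where
    factor≡1 : ∀ i j (d : Dec (j ≡ f′ i)) →
      (if does d then 1ℚ else ((finℚ (f i) - finℚ j) /' (finℚ (f′ i) - finℚ j))) ≡ 1ℚ
    factor≡1 i j (yes _)   = refl
    factor≡1 i j (no j≢f′i) =
      trans (cong (λ w → (finℚ w - finℚ j) /' (finℚ (f′ i) - finℚ j)) (sym (f′≗f i)))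
            (p/'p≡1 (Equivalence.from p-q≢0⇔p≢q (j≢f′i ∘ sym ∘ finℚ-injective)))

  lagrange-gridPoint-≢ : ∀ i → f′ i ≢ f i → lagrange n f′ (gridPoint f) ≡ 0ℚ
  lagrange-gridPoint-≢ i f′i≢fi = prodFin≡0 i (prodFin≡0 (f i) (factor≡0 (f i Fin.≟ f′ i)))
    where
    factor≡0 : (d : Dec (f i ≡ f′ i)) →
      (if does d then 1ℚ else ((finℚ (f i) - finℚ (f i)) /' (finℚ (f′ i) - finℚ (f i)))) ≡ 0ℚ
    factor≡0 (yes fi≡f′i) = contradiction (sym fi≡f′i) f′i≢fi
    factor≡0 (no _)       = trans (cong (_/' (finℚ (f′ i) - finℚ (f i))) (ℚ.+-inverseʳ (finℚ (f i))))
                                  (0/'p≡0 (finℚ (f′ i) - finℚ (f i)))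

-- Without function extensionality, H must be known to respect pointwise equality: canonical
-- evaluates H at λ i → finℚ (f′ i) for the f′ enumerated by allFuns, not at gridPoint f itself.
module _ {n : ℕ} {H : (Fin n → ℚ) → ℚ} (H-cong : ∀ {x y} → x ≗ y → H x ≡ H y) where

  canonical-gridPoint : ∀ f → canonical n H (gridPoint f) ≡ H (gridPoint f)
  canonical-gridPoint f = sumL-allFuns-δ n f (H (gridPoint f)) _
    (λ f′ f′≗f → trans (cong₂ _*_ (H-cong (cong finℚ ∘ f′≗f)) (lagrange-gridPoint-≗ f′≗f))
                       (ℚ.*-identityʳ (H (gridPoint f))))
    (λ f′ i f′i≢fi → trans (cong (H (gridPoint f′) *_) (lagrange-gridPoint-≢ {f′ = f′} {f} i f′i≢fi))
                           (ℚ.*-zeroʳ (H (gridPoint f′))))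

  notIdenticallyZero-canonical⇔ : NotIdenticallyZero n (canonical n H) ⇔ ∃ λ f → H (gridPoint f) ≢ 0ℚ
  notIdenticallyZero-canonical⇔ = mk⇔
    (λ (x , ne) → let f , ne′ = sumL-map≢0⇒ _ (allFuns n n) ne in
      f , λ Hf≡0 → ne′ (trans (cong (_* lagrange n f x) Hf≡0) (ℚ.*-zeroˡ (lagrange n f x))))
    (λ (f , ne) → gridPoint f , ne ∘ trans (sym (canonical-gridPoint f)))

-- The certificate

if-then-1≢0⇔ : ∀ {P : Set} {q} (d : Dec P) → (if does d then 1ℚ else q) ≢ 0ℚ ⇔ (¬ P → q ≢ 0ℚ)
if-then-1≢0⇔ (yes p) = mk⇔ (λ _ ¬p → contradiction p ¬p) (λ _ ())
if-then-1≢0⇔ (no ¬p) = mk⇔ (λ q≢0 _ → q≢0) (λ q≢0 → q≢0 ¬p)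

if-else-1≢0⇔ : ∀ {P : Set} {q} (d : Dec P) → (if does d then q else 1ℚ) ≢ 0ℚ ⇔ (P → q ≢ 0ℚ)
if-else-1≢0⇔ (yes p) = mk⇔ (λ q≢0 _ → q≢0) (λ q≢0 → q≢0 p)
if-else-1≢0⇔ (no ¬p) = mk⇔ (λ _ p → contradiction p ¬p) (λ _ ())

prodPairs≢0⇔ : {F : Fin n → Fin n → ℚ} → prodPairs n F ≢ 0ℚ ⇔ (∀ u v → u Fin.< v → F u v ≢ 0ℚ)
prodPairs≢0⇔ = mk⇔
  (λ ne u v u<v → Equivalence.to (if-else-1≢0⇔ (u Fin.<? v))
    (Equivalence.to prodFin≢0⇔ (Equivalence.to prodFin≢0⇔ ne u) v) u<v)
  (λ all≢0 → Equivalence.from prodFin≢0⇔ λ u → Equivalence.from prodFin≢0⇔ λ v →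
    Equivalence.from (if-else-1≢0⇔ (u Fin.<? v)) (all≢0 u v))

vandermonde≢0⇔injective : {y : Fin n → ℚ} → prodPairs n (λ u v → y v - y u) ≢ 0ℚ ⇔ Injective _≡_ _≡_ y
vandermonde≢0⇔injective {y = y} = mk⇔
  (λ ne {a} {b} → injective λ u v u<v →
    Equivalence.to p-q≢0⇔p≢q (Equivalence.to prodPairs≢0⇔ ne u v u<v))
  (λ y-inj → Equivalence.from prodPairs≢0⇔ λ u v u<v →
    Equivalence.from p-q≢0⇔p≢q λ yv≡yu → Fin.<-irrefl (sym (y-inj yv≡yu)) u<v)
  where
  injective : (∀ u v → u Fin.< v → y v ≢ y u) → Injective _≡_ _≡_ y
  injective distinct {a} {b} ya≡yb with Fin.<-cmp a b
  ... | tri< a<b _ _ = contradiction (sym ya≡yb) (distinct a b a<b)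
  ... | tri≈ _ a≡b _ = a≡b
  ... | tri> _ _ b<a = contradiction ya≡yb (distinct b a b<a)

shifts≢0⇔ : {y : Fin n → ℚ} →
  prodFin n (λ v → prodFin n (λ i → if does (Fin.toℕ i ℕ.≟ 0) then 1ℚ else y v + finℚ i)) ≢ 0ℚ
  ⇔ (∀ v (i : Fin n) → Fin.toℕ i ≢ 0 → y v + finℚ i ≢ 0ℚ)
shifts≢0⇔ = mk⇔
  (λ ne v i → Equivalence.to (if-then-1≢0⇔ (Fin.toℕ i ℕ.≟ 0))
    (Equivalence.to prodFin≢0⇔ (Equivalence.to prodFin≢0⇔ ne v) i))
  (λ all≢0 → Equivalence.from prodFin≢0⇔ λ v → Equivalence.from prodFin≢0⇔ λ i →
    Equivalence.from (if-then-1≢0⇔ (Fin.toℕ i ℕ.≟ 0)) (all≢0 v i))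

certificate≢0⇔ : ∀ {n} {g : Fin n → Fin n} {x} → certificate n g x ≢ 0ℚ ⇔
  (Injective _≡_ _≡_ x × Injective _≡_ _≡_ (𝔢 n g x) ×
   (∀ v (i : Fin n) → Fin.toℕ i ≢ 0 → 𝔢 n g x v + finℚ i ≢ 0ℚ))
certificate≢0⇔ {n} {g} {x} = mk⇔
  (λ ne → let AB≢0 , C≢0 = Equivalence.to *≢0⇔ ne
              A≢0 , B≢0 = Equivalence.to *≢0⇔ AB≢0 in
    (λ {a} {b} → Equivalence.to (vandermonde≢0⇔injective {y = x}) A≢0) ,
    (λ {a} {b} → Equivalence.to (vandermonde≢0⇔injective {y = 𝔢 n g x}) B≢0) ,
    Equivalence.to (shifts≢0⇔ {y = 𝔢 n g x}) C≢0)
  (λ (x-inj , 𝔢-inj , shifts) → Equivalence.from *≢0⇔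
    (Equivalence.from *≢0⇔ (Equivalence.from (vandermonde≢0⇔injective {y = x}) (λ {a} {b} → x-inj) ,
                            Equivalence.from (vandermonde≢0⇔injective {y = 𝔢 n g x}) (λ {a} {b} → 𝔢-inj)) ,
     Equivalence.from (shifts≢0⇔ {y = 𝔢 n g x}) shifts))

certificate-cong : ∀ {n} (g : Fin n → Fin n) {x y : Fin n → ℚ} → x ≗ y →
                   certificate n g x ≡ certificate n g y
certificate-cong {n} g {x} {y} x≗y =
  cong₂ _*_ (cong₂ _*_ (prodPairs-cong λ u v → cong₂ _-_ (x≗y v) (x≗y u))
                       (prodPairs-cong λ u v → cong₂ _-_ (𝔢-cong v) (𝔢-cong u)))
            (prodFin-cong {n} λ v → prodFin-cong {n} λ i →
              cong (λ e → if does (Fin.toℕ i ℕ.≟ 0) then 1ℚ else e + finℚ i) (𝔢-cong v))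
  where
  𝔢-cong : ∀ v → 𝔢 n g x v ≡ 𝔢 n g y v
  𝔢-cong v = cong (signℚ (depth n g v)) (cong₂ _-_ (x≗y (g v)) (x≗y v))
  prodPairs-cong : {F G : Fin n → Fin n → ℚ} → (∀ u v → F u v ≡ G u v) → prodPairs n F ≡ prodPairs n G
  prodPairs-cong F≗G = prodFin-cong {n} λ u → prodFin-cong {n} λ v →
    cong (λ e → if does (u Fin.<? v) then e else 1ℚ) (F≗G u v)

-- β-labellings through vertex numberings

-- The β-label of f v for the conjugate of g by the numbering f (see βlabel-conj);
-- βlabel n h is edgeLabel n h id.
edgeLabel : (n : ℕ) → (Fin n → Fin n) → (Fin n → Fin n) → Fin n → ℤ
edgeLabel n g f v = signℤ (depth n g v) (finℤ (f (g v)) ℤ.- finℤ (f v))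

OmitsNegatives : (Fin n → ℤ) → Set
OmitsNegatives {n} L = ∀ v (i : Fin n) → Fin.toℕ i ≢ 0 → L v ℤ.+ finℤ i ≢ 0ℤ

YieldsβLabelling : (n : ℕ) → (Fin n → Fin n) → (Fin n → Fin n) → Set
YieldsβLabelling n g f =
  Injective _≡_ _≡_ f × Injective _≡_ _≡_ (edgeLabel n g f) × OmitsNegatives (edgeLabel n g f)

signℚ-toℚ : ∀ d z → signℚ d (toℚ z) ≡ toℚ (signℤ d z)
signℚ-toℚ d z with isEven d
... | true  = refl
... | false = sym (toℚ-homo‿- z)

𝔢-gridPoint : ∀ {n} g f v → 𝔢 n g (gridPoint f) v ≡ toℚ (edgeLabel n g f v)
𝔢-gridPoint {n} g f v =
  trans (cong (signℚ (depth n g v)) (sym (toℚ-homo-minus (finℤ (f (g v))) (finℤ (f v)))))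
        (signℚ-toℚ (depth n g v) _)

injective-toℚ∘⇔ : {y : Fin n → ℚ} {L : Fin n → ℤ} → (∀ v → y v ≡ toℚ (L v)) →
                  Injective _≡_ _≡_ y ⇔ Injective _≡_ _≡_ L
injective-toℚ∘⇔ y≗L = mk⇔
  (λ y-inj {a} {b} La≡Lb → y-inj (trans (y≗L _) (trans (cong toℚ La≡Lb) (sym (y≗L _)))))
  (λ L-inj {a} {b} ya≡yb → L-inj (toℚ-injective (trans (sym (y≗L _)) (trans ya≡yb (y≗L _)))))

certificate-gridPoint≢0⇔ : ∀ {n} {g f : Fin n → Fin n} →
                           certificate n g (gridPoint f) ≢ 0ℚ ⇔ YieldsβLabelling n g f
certificate-gridPoint≢0⇔ {n} {g} {f} = mk⇔
  (λ ne → let gp-inj , 𝔢-inj , shifts = Equivalence.to certificate≢0⇔ ne in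
    (λ {a} {b} fa≡fb → gp-inj (cong finℚ fa≡fb)) ,
    (λ {a} {b} → Equivalence.to (injective-toℚ∘⇔ (𝔢-gridPoint g f)) 𝔢-inj) ,
    λ v i i≢0 Lv+i≡0 → shifts v i i≢0 (trans (shift-toℚ v i) (cong toℚ Lv+i≡0)))
  (λ (f-inj , L-inj , omits) → Equivalence.from certificate≢0⇔
    ((λ {a} {b} gpa≡gpb → f-inj (finℚ-injective gpa≡gpb)) ,
     (λ {a} {b} → Equivalence.from (injective-toℚ∘⇔ (𝔢-gridPoint g f)) L-inj) ,
     λ v i i≢0 𝔢+i≡0 → omits v i i≢0 (toℚ-injective (trans (sym (shift-toℚ v i)) 𝔢+i≡0))))
  where
  shift-toℚ : ∀ v (i : Fin n) → 𝔢 n g (gridPoint f) v + finℚ i ≡ toℚ (edgeLabel n g f v ℤ.+ finℤ i)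
  shift-toℚ v i = trans (cong (_+ finℚ i) (𝔢-gridPoint g f v)) (sym (toℚ-homo-+ (edgeLabel n g f v) (finℤ i)))

least-cong : ∀ k {p q : ℕ → Bool} → (∀ j → p j ≡ q j) → least k p ≡ least k q
least-cong zero    p≗q = refl
least-cong (suc k) p≗q rewrite p≗q 0 = cong (λ l → if _ then 0 else suc l) (least-cong k (p≗q ∘ suc))

does-≟-injective : {φ : Fin n → Fin n} → Injective _≡_ _≡_ φ →
                   ∀ a b → does (φ a Fin.≟ φ b) ≡ does (a Fin.≟ b)
does-≟-injective {φ = φ} φ-inj a b with a Fin.≟ b | φ a Fin.≟ φ b
... | yes _    | yes _       = refl
... | no  _    | no  _       = refl
... | yes refl | no  φa≢φa   = contradiction refl φa≢φa
... | no  a≢b  | yes φa≡φb   = contradiction (φ-inj φa≡φb) a≢b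

module _ {n : ℕ} (σ : Fin n ↔ Fin n) (g : Fin n → Fin n) where
  open Inverse σ using (to; from; strictlyInverseʳ)

  conj-to : ∀ u → conj σ g (to u) ≡ to (g u)
  conj-to u = cong (to ∘ g) (strictlyInverseʳ u)

  iterate-conj : ∀ j u → iterate j (conj σ g) (to u) ≡ to (iterate j g u)
  iterate-conj zero    u = refl
  iterate-conj (suc j) u = trans (cong (conj σ g) (iterate-conj j u)) (conj-to (iterate j g u))

  depth-conj : ∀ u → depth n (conj σ g) (to u) ≡ depth n g u
  depth-conj u = least-cong n λ j →
    trans (cong₂ (λ a b → does (a Fin.≟ b)) (iterate-conj j u) (iterate-conj (n ℕ.∸ 1) u))
          (does-≟-injective (Injection.injective (↔⇒↣ σ)) (iterate j g u) (iterate (n ℕ.∸ 1) g u))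

  βlabel-conj : ∀ u → βlabel n (conj σ g) (to u) ≡ edgeLabel n g to u
  βlabel-conj u = cong₂ (λ d w → signℤ d (finℤ w ℤ.- finℤ (to u))) (depth-conj u) (conj-to u)

-- LabelSetIsZn n h unfolds to RangeIsZn (βlabel n h).
RangeIsZn : (Fin n → ℤ) → Set
RangeIsZn {n} L = ((v : Fin n) → ∃ λ (k : Fin n) → L v ≡ finℤ k)
                 × ((k : Fin n) → ∃ λ (v : Fin n) → L v ≡ finℤ k)

∣signℤ∣ : ∀ d z → ℤ.∣ signℤ d z ∣ ≡ ℤ.∣ z ∣
∣signℤ∣ d z with isEven d
... | true  = refl
... | false = ℤ.∣-i∣≡∣i∣ z

edgeLabel-bounded : ∀ {n} (g f : Fin n → Fin n) v → ℤ.∣ edgeLabel n g f v ∣ ℕ.< n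
edgeLabel-bounded {n} g f v = begin-strict
  ℤ.∣ edgeLabel n g f v ∣        ≡⟨ ∣signℤ∣ (depth n g v) _ ⟩
  ℤ.∣ finℤ a ℤ.- finℤ b ∣        ≡⟨ cong ℤ.∣_∣ (ℤ.m-n≡m⊖n (Fin.toℕ a) (Fin.toℕ b)) ⟩
  ℤ.∣ Fin.toℕ a ℤ.⊖ Fin.toℕ b ∣  ≤⟨ ℤ.∣m⊝n∣≤m⊔n (Fin.toℕ a) (Fin.toℕ b) ⟩
  Fin.toℕ a ℕ.⊔ Fin.toℕ b        <⟨ ℕ.⊔-pres-<m (Fin.toℕ<n a) (Fin.toℕ<n b) ⟩
  n                              ∎
  where
  open ℕ.≤-Reasoning
  a = f (g v)
  b = f v

bounded-omitsNegatives⇒∈Zn : ∀ {n} z → ℤ.∣ z ∣ ℕ.< n →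
                             (∀ (i : Fin n) → Fin.toℕ i ≢ 0 → z ℤ.+ finℤ i ≢ 0ℤ) →
                             ∃ λ (k : Fin n) → z ≡ finℤ k
bounded-omitsNegatives⇒∈Zn (ℤ.+ m) m<n _ = Fin.fromℕ< m<n , cong ℤ.+_ (sym (Fin.toℕ-fromℕ< m<n))
bounded-omitsNegatives⇒∈Zn ℤ.-[1+ j ] j<n omits = contradiction z+i≡0 (omits i i≢0)
  where
  i = Fin.fromℕ< j<n
  i≢0 : Fin.toℕ i ≢ 0
  i≢0 = ℕ.1+n≢0 ∘ trans (sym (Fin.toℕ-fromℕ< j<n))
  z+i≡0 : ℤ.-[1+ j ] ℤ.+ finℤ i ≡ 0ℤ
  z+i≡0 = trans (cong (λ m → ℤ.-[1+ j ] ℤ.+ ℤ.+ m) (Fin.toℕ-fromℕ< j<n)) (ℤ.n⊖n≡0 (suc j))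

rangeIsZn⇔ : {L : Fin n → ℤ} → (∀ v → ℤ.∣ L v ∣ ℕ.< n) →
             RangeIsZn L ⇔ (Injective _≡_ _≡_ L × OmitsNegatives L)
rangeIsZn⇔ {n} {L} bounded = mk⇔
  (λ (in-Zn , onto) →
    let value = proj₁ ∘ in-Zn
        value-injective = surjective⇒injective λ k → let v , Lv≡k = onto k in
          v , finℤ-injective (trans (sym (proj₂ (in-Zn v))) Lv≡k)
    in (λ {a} {b} La≡Lb → value-injective (finℤ-injective
          (trans (sym (proj₂ (in-Zn a))) (trans La≡Lb (proj₂ (in-Zn b)))))) ,
       λ v i i≢0 Lv+i≡0 → i≢0 (ℕ.m+n≡0⇒n≡0 (Fin.toℕ (value v))
         (ℤ.+-injective (trans (cong (ℤ._+ finℤ i) (sym (proj₂ (in-Zn v)))) Lv+i≡0))))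
  (λ (L-inj , omits) →
    let in-Zn v = bounded-omitsNegatives⇒∈Zn (L v) (bounded v) (omits v)
        value-injective : Injective _≡_ _≡_ (proj₁ ∘ in-Zn)
        value-injective ka≡kb =
          L-inj (trans (proj₂ (in-Zn _)) (trans (cong finℤ ka≡kb) (sym (proj₂ (in-Zn _)))))
    in in-Zn , λ k → let v , kv≡k = injective⇒surjective value-injective k in
         v , trans (proj₂ (in-Zn v)) (cong finℤ kv≡k))

rangeIsZn-∘↔ : {L M : Fin n → ℤ} (π : Fin n ↔ Fin n) → (∀ u → L (Inverse.to π u) ≡ M u) →
               RangeIsZn L → RangeIsZn M
rangeIsZn-∘↔ {L = L} π L∘π≗M (in-Zn , onto) =
  (λ u → let k , e = in-Zn (to u) in k , trans (sym (L∘π≗M u)) e) ,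
  (λ k → let v , e = onto k in
    from v , trans (sym (L∘π≗M (from v))) (trans (cong L (strictlyInverseˡ v)) e))
  where open Inverse π using (to; from; strictlyInverseˡ)

admitsβLabeling⇔ : ∀ {n} {g : Fin n → Fin n} → AdmitsβLabeling n g ⇔ ∃ (YieldsβLabelling n g)
admitsβLabeling⇔ {n} {g} = mk⇔
  (λ (σ , labels) →
    let L-inj , omits = Equivalence.to (rangeIsZn⇔ (edgeLabel-bounded g (Inverse.to σ)))
                          (rangeIsZn-∘↔ σ (βlabel-conj σ g) labels)
    in Inverse.to σ , Injection.injective (↔⇒↣ σ) , L-inj , omits)
  (λ (f , f-inj , L-inj , omits) →
    let σ = injective⇒↔ f-inj
        open Inverse σ using (from; strictlyInverseˡ)
    in σ , rangeIsZn-∘↔ (↔-sym σ)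
             (λ u → trans (sym (βlabel-conj σ g (from u))) (cong (βlabel n (conj σ g)) (strictlyInverseˡ u)))
             (Equivalence.from (rangeIsZn⇔ (edgeLabel-bounded g f)) ((λ {a} {b} → L-inj) , omits)))

notIdenticallyZero⇔admitsβLabeling : ∀ {n} {g : Fin n → Fin n} →
  NotIdenticallyZero n (canonical n (certificate n g)) ⇔ AdmitsβLabeling n g
notIdenticallyZero⇔admitsβLabeling {g = g} =
  ⇔.trans (notIdenticallyZero-canonical⇔ (certificate-cong g))
  (⇔.trans (mk⇔ (map₂ (Equivalence.to certificate-gridPoint≢0⇔))
                (map₂ (Equivalence.from certificate-gridPoint≢0⇔)))
           (⇔.sym admitsβLabeling⇔))

-- Functional trees

∈-tabulate⇔ : {P : Fin n → Bool} {w : Fin n} → w ∈ₛ Vec.tabulate P ⇔ P w ≡ true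
∈-tabulate⇔ {P = P} {w} = mk⇔
  (λ w∈ → trans (sym (Vec.lookup∘tabulate P w)) (Vec.[]=⇒lookup w∈))
  (λ Pw≡true → Vec.lookup⇒[]= w (Vec.tabulate P) (trans (Vec.lookup∘tabulate P w) Pw≡true))

∈imageIter⇔ : ∀ {n} {g : Fin n → Fin n} {w} →
              w ∈ₛ imageIter n g ⇔ ∃ λ v → iterate (n ℕ.∸ 1) g v ≡ w
∈imageIter⇔ {n} {g} {w} = ⇔.trans ∈-tabulate⇔
  (mk⇔ witness (dec-true image?))
  where
  image? = Fin.any? λ v → iterate (n ℕ.∸ 1) g v Fin.≟ w
  witness : does image? ≡ true → ∃ λ v → iterate (n ℕ.∸ 1) g v ≡ w
  witness does≡true with image?
  ... | yes hit = hit

∣p∣≡1⇒∈-unique : {p : Subset n} {x y : Fin n} → ∣ p ∣ ≡ 1 → x ∈ₛ p → y ∈ₛ p → x ≡ y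
∣p∣≡1⇒∈-unique {p = p} {x} {y} ∣p∣≡1 x∈p y∈p with y Fin.≟ x
... | yes y≡x = sym y≡x
... | no  y≢x = contradiction ∣p-x∣<1 (ℕ.≤⇒≯ 1≤∣p-x∣)
  where
  ∣p-x∣<1 : ∣ p Subset.- x ∣ ℕ.< 1
  ∣p-x∣<1 = subst (∣ p Subset.- x ∣ ℕ.<_) ∣p∣≡1 (Subset.x∈p⇒∣p-x∣<∣p∣ x∈p)
  1≤∣p-x∣ : 1 ℕ.≤ ∣ p Subset.- x ∣
  1≤∣p-x∣ = subst (ℕ._≤ ∣ p Subset.- x ∣) (Subset.∣⁅x⁆∣≡1 y)
    (Subset.p⊆q⇒∣p∣≤∣q∣ λ z∈⁅y⁆ →
      subst (_∈ₛ p Subset.- x) (sym (Subset.x∈⁅y⁆⇒x≡y y z∈⁅y⁆)) (Subset.x∈p∧x≢y⇒x∈p-y y∈p y≢x))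

isFunctionalTree⇔ : {g : Fin (suc n) → Fin (suc n)} →
                    IsFunctionalTree (suc n) g ⇔ ∃ λ r → ∀ v → iterate n g v ≡ r
isFunctionalTree⇔ {n} {g} = mk⇔
  (λ tree → iterate n g Fin.zero , λ v →
    ∣p∣≡1⇒∈-unique tree (Equivalence.from ∈imageIter⇔ (v , refl))
                        (Equivalence.from ∈imageIter⇔ (Fin.zero , refl)))
  (λ (r , rooted) → trans (cong ∣_∣ (image≡⁅r⁆ r rooted)) (Subset.∣⁅x⁆∣≡1 r))
  where
  image≡⁅r⁆ : ∀ r → (∀ v → iterate n g v ≡ r) → imageIter (suc n) g ≡ ⁅ r ⁆
  image≡⁅r⁆ r rooted = Subset.⊆-antisym
    (λ w∈ → let v , gv≡w = Equivalence.to ∈imageIter⇔ w∈ in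
      Equivalence.from Subset.x∈⁅y⁆⇔x≡y (trans (sym gv≡w) (rooted v)))
    (λ w∈⁅r⁆ → Equivalence.from ∈imageIter⇔
      (Fin.zero , trans (rooted Fin.zero) (sym (Subset.x∈⁅y⁆⇒x≡y r w∈⁅r⁆))))

iterate-+ : ∀ {n} (g : Fin n → Fin n) a b v → iterate (a ℕ.+ b) g v ≡ iterate a g (iterate b g v)
iterate-+ g zero    b v = refl
iterate-+ g (suc a) b v = cong g (iterate-+ g a b v)

iterate-sq : ∀ {n} (g : Fin n → Fin n) j v → iterate j (sq g) v ≡ iterate (j ℕ.+ j) g v
iterate-sq g zero    v = refl
iterate-sq g (suc j) v =
  trans (cong (g ∘ g) (iterate-sq g j v)) (cong (λ e → iterate e g v) (sym (cong suc (ℕ.+-suc j j))))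

module _ {n : ℕ} {g : Fin n → Fin n} {r : Fin n} {m : ℕ} (rooted : ∀ v → iterate m g v ≡ r) where

  rooted-≤ : ∀ {m′} → m ℕ.≤ m′ → ∀ v → iterate m′ g v ≡ r
  rooted-≤ {m′} m≤m′ v = begin
    iterate m′ g v                            ≡⟨ cong (λ e → iterate e g v) (sym (ℕ.m+[n∸m]≡n m≤m′)) ⟩
    iterate (m ℕ.+ (m′ ℕ.∸ m)) g v            ≡⟨ iterate-+ g m (m′ ℕ.∸ m) v ⟩
    iterate m g (iterate (m′ ℕ.∸ m) g v)      ≡⟨ rooted _ ⟩
    r                                         ∎
    where open ≡-Reasoning

  rooted-sq : ∀ v → iterate m (sq g) v ≡ r
  rooted-sq v = trans (iterate-sq g m v) (rooted-≤ (ℕ.m≤m+n m m) v)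

repeatedSquare : ∀ {n} → ℕ → (Fin n → Fin n) → Fin n → Fin n
repeatedSquare zero    g = g
repeatedSquare (suc k) g = sq (repeatedSquare k g)

repeatedSquare-rooted : ∀ {n} (g : Fin n → Fin n) m {r} → (∀ v → iterate m g v ≡ r) →
                        ∀ k v → iterate m (repeatedSquare k g) v ≡ r
repeatedSquare-rooted g m rooted zero    = rooted
repeatedSquare-rooted g m rooted (suc k) =
  rooted-sq {g = repeatedSquare k g} {m = m} (repeatedSquare-rooted g m rooted k)

repeatedSquare≗iterate : ∀ {n} (g : Fin n → Fin n) k v → repeatedSquare k g v ≡ iterate (2 ℕ.^ k) g v
repeatedSquare≗iterate g zero    v = refl
repeatedSquare≗iterate g (suc k) v = begin
  repeatedSquare k g (repeatedSquare k g v)  ≡⟨ repeatedSquare≗iterate g k _ ⟩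
  iterate e g (repeatedSquare k g v)         ≡⟨ cong (iterate e g) (repeatedSquare≗iterate g k v) ⟩
  iterate e g (iterate e g v)                ≡⟨ iterate-+ g e e v ⟨
  iterate (e ℕ.+ e) g v                      ≡⟨ cong (λ e′ → iterate (e ℕ.+ e′) g v) (ℕ.+-identityʳ e) ⟨
  iterate (2 ℕ.^ suc k) g v                  ∎
  where
  open ≡-Reasoning
  e = 2 ℕ.^ k

n<2^n : ∀ k → k ℕ.< 2 ℕ.^ k
n<2^n zero    = ℕ.s≤s ℕ.z≤n
n<2^n (suc k) = subst (ℕ._≤ 2 ℕ.^ suc k) (ℕ.+-comm (suc k) 1)
  (ℕ.+-mono-≤ (n<2^n k) (ℕ.≤-trans (ℕ.m^n>0 2 k) (ℕ.m≤m+n (2 ℕ.^ k) 0)))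

repeatedSquare-constant : ∀ {n} (g : Fin n → Fin n) m {r} → (∀ v → iterate m g v ≡ r) →
                          ∀ v → repeatedSquare m g v ≡ r
repeatedSquare-constant g m rooted v =
  trans (repeatedSquare≗iterate g m v) (rooted-≤ rooted (ℕ.<⇒≤ (n<2^n m)) v)

depth-const : ∀ {n} {h : Fin n → Fin n} {r v} → (∀ u → h u ≡ r) → v ≢ r → depth n h v ≡ 1
depth-const {suc zero}    {r = Fin.zero} {Fin.zero} _ v≢r = contradiction refl v≢r
depth-const {suc (suc k)} {h} {r} {v} h≡r v≢r
  rewrite dec-false (v Fin.≟ iterate (suc k) h v) (v≢r ∘ λ v≡hⁿv → trans v≡hⁿv (h≡r _))
        | dec-true (h v Fin.≟ iterate (suc k) h v) (trans (h≡r v) (sym (h≡r _))) = refl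

signℤ-0 : ∀ d → signℤ d 0ℤ ≡ 0ℤ
signℤ-0 d with isEven d
... | true  = refl
... | false = refl

edgeLabel-const : ∀ {n} {h f : Fin (suc n) → Fin (suc n)} {r} → (∀ u → h u ≡ r) → f r ≡ Fin.zero →
                  ∀ v → edgeLabel (suc n) h f v ≡ finℤ (f v)
edgeLabel-const {m} {h} {f} {r} h≡r fr≡0 v =
  trans (cong (λ w → signℤ d (finℤ (f w) ℤ.- finℤ (f v))) (h≡r v)) (root-or-not (v Fin.≟ r))
  where
  d = depth (suc m) h v
  root-or-not : Dec (v ≡ r) → signℤ d (finℤ (f r) ℤ.- finℤ (f v)) ≡ finℤ (f v)
  root-or-not (yes refl) = begin
    signℤ d (finℤ (f v) ℤ.- finℤ (f v))  ≡⟨ cong (signℤ d) (ℤ.+-inverseʳ (finℤ (f v))) ⟩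
    signℤ d 0ℤ                          ≡⟨ signℤ-0 d ⟩
    0ℤ                                  ≡⟨ cong finℤ fr≡0 ⟨
    finℤ (f v)                          ∎
    where open ≡-Reasoning
  root-or-not (no v≢r) = begin
    signℤ d (finℤ (f r) ℤ.- finℤ (f v))  ≡⟨ cong (λ e → signℤ e (finℤ (f r) ℤ.- finℤ (f v))) (depth-const h≡r v≢r) ⟩
    ℤ.- (finℤ (f r) ℤ.- finℤ (f v))     ≡⟨ cong (λ w → ℤ.- (finℤ w ℤ.- finℤ (f v))) fr≡0 ⟩
    ℤ.- (0ℤ ℤ.- finℤ (f v))             ≡⟨ cong ℤ.-_ (ℤ.+-identityˡ (ℤ.- finℤ (f v))) ⟩
    ℤ.- ℤ.- finℤ (f v)                  ≡⟨ ℤ.neg-involutive (finℤ (f v)) ⟩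
    finℤ (f v)                          ∎
    where open ≡-Reasoning

const-yieldsβLabelling : ∀ {n} {h f : Fin (suc n) → Fin (suc n)} {r} → (∀ u → h u ≡ r) →
                         Injective _≡_ _≡_ f → f r ≡ Fin.zero → YieldsβLabelling (suc n) h f
const-yieldsβLabelling {n} {h} {f} h≡r f-inj fr≡0 =
  f-inj ,
  (λ {a} {b} La≡Lb → f-inj (finℤ-injective (trans (sym (label a)) (trans La≡Lb (label b))))) ,
  λ v i i≢0 Lv+i≡0 → i≢0 (ℕ.m+n≡0⇒n≡0 (Fin.toℕ (f v))
    (ℤ.+-injective (trans (cong (ℤ._+ finℤ i) (sym (label v))) Lv+i≡0)))
  where
  label = edgeLabel-const h≡r fr≡0

const-admitsβLabeling : ∀ {n} {h : Fin (suc n) → Fin (suc n)} {r} → (∀ u → h u ≡ r) →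
                        AdmitsβLabeling (suc n) h
const-admitsβLabeling {r = r} h≡r = Equivalence.from admitsβLabeling⇔
  (Inverse.to τ , const-yieldsβLabelling h≡r (Injection.injective (↔⇒↣ τ)) τr≡0)
  where
  τ = Permutation.transpose r Fin.zero
  τr≡0 : Inverse.to τ r ≡ Fin.zero
  τr≡0 rewrite dec-true (r Fin.≟ r) refl = refl

downward-induction : (P : ℕ → Set) → (∀ k → P (suc k) → P k) → ∀ k → P k → P 0
downward-induction P step zero    p = p
downward-induction P step (suc k) p = downward-induction P step k (step k p)

labelled-if-squaring-reflects : ∀ {m} →
  ((g : Fin (suc m) → Fin (suc m)) → IsFunctionalTree (suc m) g →
    AdmitsβLabeling (suc m) (sq g) → AdmitsβLabeling (suc m) g) →
  (g : Fin (suc m) → Fin (suc m)) → IsFunctionalTree (suc m) g → AdmitsβLabeling (suc m) g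
labelled-if-squaring-reflects {m} reflects g tree =
  let r , rooted = Equivalence.to isFunctionalTree⇔ tree in
  downward-induction (λ k → AdmitsβLabeling (suc m) (repeatedSquare k g))
    (λ k → reflects (repeatedSquare k g)
             (Equivalence.from isFunctionalTree⇔ (r , repeatedSquare-rooted g m rooted k)))
    m (const-admitsβLabeling (repeatedSquare-constant g m rooted))

proposition2p2 : (n : ℕ) → 0 < n →
    (((g : Fin n → Fin n) → IsFunctionalTree n g → AdmitsβLabeling n g)
    ⇔ ((g : Fin n → Fin n) → IsFunctionalTree n g →
         NotIdenticallyZero n (canonical n (certificate n (sq g))) →
         NotIdenticallyZero n (canonical n (certificate n g))))
proposition2p2 (suc m) _ = mk⇔
  (λ all-labelled g tree _ → Equivalence.from notIdenticallyZero⇔admitsβLabeling (all-labelled g tree))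
  (λ reflects → labelled-if-squaring-reflects λ g tree →
    Equivalence.to notIdenticallyZero⇔admitsβLabeling
    ∘ reflects g tree
    ∘ Equivalence.from notIdenticallyZero⇔admitsβLabeling)
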